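{- Let $\mathcal{A}$ be a partial combinatory algebra in which $\bar 0,\bar 1$ are separable, and let $\gamma:\mathcal{A}\to S$ be a precomplete generalized numbering. Then $\gamma$ is not injective.
   Context: A pca $\mathcal{A}$ is a set with a partial, left-associative, strict application that is combinatory complete; equivalently it has $k,s$ with $kab=a$, $sab\downarrow$, $sabc\simeq ac(bc)$. An element $f$ is total if $fa$ is defined for all $a$. With combinatory abstraction $\lambda^*$, put $i=skk$, $\mathsf{false}=ki$, $\langle a,b\rangle=\lambda^*z.zab$, numerals $\bar 0=i$, $\bar 1=\langle\mathsf{false},\bar 0\rangle$. $\bar 0,\bar 1$ are separable in $\mathcal{A}$ if there is a total $c\in\mathcal{A}$ with $ca\in\{\bar 0,\bar 1\}$ for all $a$, such that $ca=\bar 0\Rightarrow a\ne\bar 1$ and $ca=\bar 1\Rightarrow a\ne\bar 0$. A generalized numbering is a surjective function $\gamma:\mathcal{A}\to S$ onto a set $S$; write $a\sim_\gamma b$ iff $\gamma(a)=\gamma(b)$. $\gamma$ is precomplete if for every $b\in\mathcal{A}$ there is a total $f\in\mathcal{A}$ such that for all $a\in\mathcal{A}$, $ba\downarrow$ implies $fa\sim_\gamma ba$. -}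

module Defs where

open import Level using (Level; _⊔_)
open import Data.Nat using (ℕ)
open import Data.Fin using (Fin; zero; suc)
open import Data.Product using (Σ; ∃; ∃-syntax; _×_; _,_)
open import Data.Sum using (_⊎_)
open import Relation.Nullary using (¬_)
open import Relation.Binary.PropositionalEquality using (_≡_)
open import Function.Definitions using (Injective; Surjective)

-- A partial combinatory algebra.  Partial application is a functional
-- relation  App a b v  ("a b is defined and equals v").
record PCA (ℓ : Level) : Set (Level.suc ℓ) where
  field
    Carrier : Set ℓ
    App     : Carrier → Carrier → Carrier → Set ℓ
    App-functional : ∀ {a b v w} → App a b v → App a b w → v ≡ w
    k s : Carrier
    k-ax  : ∀ a b → ∃[ d ] (App k a d × App d b a)
    s-def : ∀ a b → ∃[ d ] ∃[ e ] (App s a d × App d b e)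
    -- s a b c ≃ a c (b c)   (Kleene equality)
    s-ax  : ∀ a b c d e → App s a d → App d b e →
            ∀ v → (App e c v → ∃[ x ] ∃[ y ] (App a c x × App b c y × App x y v))
                × ((∃[ x ] ∃[ y ] (App a c x × App b c y × App x y v)) → App e c v)

module PCATheory {ℓ : Level} (𝒜 : PCA ℓ) where
  open PCA 𝒜 public

  infixl 9 _·_
  data Term (n : ℕ) : Set ℓ where
    var   : Fin n → Term n
    const : Carrier → Term n
    _·_   : Term n → Term n → Term n

  data _⇓_ : Term 0 → Carrier → Set ℓ where
    const⇓ : ∀ a → const a ⇓ a
    app⇓   : ∀ {t u x y v} → t ⇓ x → u ⇓ y → App x y v → (t · u) ⇓ v

  K S : ∀ {n} → Term n
  K = const k
  S = const s

  I : ∀ {n} → Term n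
  I = S · K · K

  λ* : ∀ {n} → Term (ℕ.suc n) → Term n
  λ* (var zero)    = I
  λ* (var (suc j)) = K · var j
  λ* (const a)     = K · const a
  λ* (t · u)       = S · λ* t · λ* u

  weaken : ∀ {n} → Term n → Term (ℕ.suc n)
  weaken (var j)   = var (suc j)
  weaken (const a) = const a
  weaken (t · u)   = weaken t · weaken u

  false : Term 0
  false = K · I

  ⟨_,_⟩ : Term 0 → Term 0 → Term 0
  ⟨ t , u ⟩ = λ* (var zero · weaken t · weaken u)

  numeral0 numeral1 : Term 0
  numeral0 = I
  numeral1 = ⟨ false , numeral0 ⟩

  Total : Carrier → Set ℓ
  Total f = ∀ a → ∃[ v ] App f a v

  Separable01 : Set ℓ
  Separable01 =
    Σ Carrier λ c → Total c ×
      (∀ a → ∃[ v ] (App c a v ×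
        ((numeral0 ⇓ v × ¬ (numeral1 ⇓ a)) ⊎ (numeral1 ⇓ v × ¬ (numeral0 ⇓ a)))))

  IsGeneralizedNumbering : ∀ {ℓ'} {S : Set ℓ'} → (Carrier → S) → Set (ℓ ⊔ ℓ')
  IsGeneralizedNumbering {S = S} γ = Surjective _≡_ _≡_ γ

  Precomplete : ∀ {ℓ'} {S : Set ℓ'} → (Carrier → S) → Set (ℓ ⊔ ℓ')
  Precomplete γ =
    ∀ b → Σ Carrier λ f → Total f ×
      (∀ a v → App b a v → ∃[ w ] (App f a w × γ w ≡ γ v))

module Submission where

-- If γ were injective, precompleteness would turn every partial b into a total
-- f extending it (f a = b a whenever b a is defined).  Applied to the
-- self-application combinator λx.xx this yields a total f with f a = a a
-- whenever a a is defined.  Such an f cannot exist when a total c separates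
-- 0̄ from 1̄: for e = λx. c (f x) 1̄ put v = f e.  If c v = 0̄ then
-- e e = 0̄ 1̄ = 1̄, so v = 1̄, which c v = 0̄ forbids; if c v = 1̄ then
-- e e = 1̄ 1̄ = false false 0̄ = 0̄, so v = 0̄, which c v = 1̄ forbids.
--
-- Then come the diagonal
-- argument and the passage from precompleteness to total extensions.

open import Defs
open import Level using (Level)
open import Relation.Nullary using (¬_)
open import Relation.Binary.PropositionalEquality using (_≡_; refl; sym; cong₂; subst)
open import Function.Definitions using (Injective)
open import Data.Fin using (zero)
open import Data.Product using (Σ; ∃-syntax; _×_; _,_; proj₁; proj₂)
open import Data.Sum using (_⊎_; inj₁; inj₂)
open import Data.Empty using (⊥)

module Combinatory {ℓ : Level} (𝒜 : PCA ℓ) where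
  open PCATheory 𝒜

  ⇓-functional : ∀ {t x y} → t ⇓ x → t ⇓ y → x ≡ y
  ⇓-functional (const⇓ _) (const⇓ _) = refl
  ⇓-functional (app⇓ t⇓x u⇓y xy) (app⇓ t⇓x' u⇓y' x'y')
    with ⇓-functional t⇓x t⇓x' | ⇓-functional u⇓y u⇓y'
  ... | refl | refl = App-functional xy x'y'

  k-β : ∀ {a d} → App k a d → ∀ b → App d b a
  k-β {a} ka b with k-ax a b
  ... | d , ka' , db with App-functional ka ka'
  ... | refl = db

  infixl 30 _[_]
  _[_] : Term 1 → Carrier → Term 0
  var zero [ a ] = const a
  const c  [ a ] = const c
  (t · u)  [ a ] = t [ a ] · u [ a ]

  weaken-[] : ∀ (t : Term 0) a → weaken t [ a ] ≡ t
  weaken-[] (const c) a = refl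
  weaken-[] (t · u)   a = cong₂ _·_ (weaken-[] t a) (weaken-[] u a)

  -- An abstraction is always defined, because s a b and k a are.
  λ*-defined : (t : Term 1) → ∃[ f ] (λ* t ⇓ f)
  λ*-defined (var zero) with s-def k k
  ... | d , e , sk , skk = e , app⇓ (app⇓ (const⇓ s) (const⇓ k) sk) (const⇓ k) skk
  λ*-defined (const c) with k-ax c c
  ... | d , kc , _ = d , app⇓ (const⇓ k) (const⇓ c) kc
  λ*-defined (t · u) with λ*-defined t | λ*-defined u
  ... | x , t⇓x | y , u⇓y with s-def x y
  ... | d , e , sx , sxy = e , app⇓ (app⇓ (const⇓ s) t⇓x sx) u⇓y sxy

  -- For a variable this is s k k a = k a (k a) = a; for an application it is
  -- the s-axiom together with the induction hypotheses.
  λ*-β : (t : Term 1) → ∀ {f a v} → λ* t ⇓ f → t [ a ] ⇓ v → App f a v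
  λ*-β (var zero) {a = a} (app⇓ (app⇓ (const⇓ _) (const⇓ _) sk) (const⇓ _) skk) (const⇓ _)
    with k-ax a a
  ... | ka , k-a , _ = proj₂ (s-ax k k a _ _ sk skk a) (ka , ka , k-a , k-a , k-β k-a ka)
  λ*-β (const c) (app⇓ (const⇓ _) (const⇓ _) kc) (const⇓ _) = k-β kc _
  λ*-β (t · u) (app⇓ (app⇓ (const⇓ _) t⇓x sx) u⇓y sxy) (app⇓ ta ua app) =
    proj₂ (s-ax _ _ _ _ _ sx sxy _) (_ , _ , λ*-β t t⇓x ta , λ*-β u u⇓y ua , app)

  pair-β : ∀ {t u p x y z g v} → ⟨ t , u ⟩ ⇓ p → t ⇓ x → u ⇓ y →
           App z x g → App g y v → App p z v
  pair-β {t} {u} {z = z} {v = v} p⇓ t⇓x u⇓y zx gy =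
    λ*-β (var zero · weaken t · weaken u) p⇓ body⇓
    where
    body⇓ : (const z · weaken t [ z ] · weaken u [ z ]) ⇓ v
    body⇓ = subst (λ w → w ⇓ v)
                  (sym (cong₂ (λ t' u' → const z · t' · u') (weaken-[] t z) (weaken-[] u z)))
                  (app⇓ (app⇓ (const⇓ z) t⇓x zx) u⇓y gy)

  iᶜ : Carrier
  iᶜ = proj₁ (λ*-defined (var zero))

  I⇓ : I ⇓ iᶜ
  I⇓ = proj₂ (λ*-defined (var zero))

  i-β : ∀ a → App iᶜ a a
  i-β a = λ*-β (var zero) I⇓ (const⇓ a)

  falseᶜ : Carrier
  falseᶜ = proj₁ (k-ax iᶜ iᶜ)

  k-i : App k iᶜ falseᶜ
  k-i = proj₁ (proj₂ (k-ax iᶜ iᶜ))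

  false⇓ : false ⇓ falseᶜ
  false⇓ = app⇓ (const⇓ k) I⇓ k-i

  oneᶜ : Carrier
  oneᶜ = proj₁ (λ*-defined (var zero · weaken false · weaken numeral0))

  one⇓ : numeral1 ⇓ oneᶜ
  one⇓ = proj₂ (λ*-defined (var zero · weaken false · weaken numeral0))

  -- 1̄ 1̄ = 1̄ false 0̄ = 0̄; this is the only numeral computation the diagonal
  -- argument needs.
  one-one : App oneᶜ oneᶜ iᶜ
  one-one = pair-β one⇓ false⇓ I⇓ one-false (i-β iᶜ)
    where
    -- 1̄ false = false false 0̄ = i 0̄ = 0̄.
    one-false : App oneᶜ falseᶜ iᶜ
    one-false = pair-β one⇓ false⇓ I⇓ (k-β k-i falseᶜ) (i-β iᶜ)

  selfTerm : Term 1
  selfTerm = var zero · var zero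

  selfᶜ : Carrier
  selfᶜ = proj₁ (λ*-defined selfTerm)

  self-β : ∀ {a v} → App a a v → App selfᶜ a v
  self-β {a} aa =
    λ*-β selfTerm (proj₂ (λ*-defined selfTerm)) (app⇓ (const⇓ a) (const⇓ a) aa)

  _Extends_ : Carrier → Carrier → Set ℓ
  f Extends b = ∀ {a v} → App b a v → App f a v

  module Diagonal (c f : Carrier) where
    eTerm : Term 1
    eTerm = const c · (const f · var zero) · const oneᶜ

    eᶜ : Carrier
    eᶜ = proj₁ (λ*-defined eTerm)

    e-β : ∀ {v x r} → App f eᶜ v → App c v x → App x oneᶜ r → App eᶜ eᶜ r
    e-β fe cv xr =
      λ*-β eTerm (proj₂ (λ*-defined eTerm))
           (app⇓ (app⇓ (const⇓ c) (app⇓ (const⇓ f) (const⇓ eᶜ) fe) cv) (const⇓ oneᶜ) xr)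

  self-application-not-totalizable :
    Separable01 → ∀ f → Total f → ¬ (f Extends selfᶜ)
  self-application-not-totalizable (c , _ , separates) f f-total f-self =
    refute (proj₂ (proj₂ (separates v)))
    where
    open Diagonal c f

    v : Carrier
    v = proj₁ (f-total eᶜ)

    fe : App f eᶜ v
    fe = proj₂ (f-total eᶜ)

    x : Carrier
    x = proj₁ (separates v)

    cv : App c v x
    cv = proj₁ (proj₂ (separates v))

    -- Since c v = x, whatever x 1̄ evaluates to is e e, hence f e = v.
    fixed : ∀ {y r} → x ≡ y → App y oneᶜ r → r ≡ v
    fixed refl xr = App-functional (f-self (self-β (e-β fe cv xr))) fe

    refute : (numeral0 ⇓ x × ¬ (numeral1 ⇓ v)) ⊎ (numeral1 ⇓ x × ¬ (numeral0 ⇓ v)) → ⊥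
    refute (inj₁ (zero⇓x , v≢1)) =
      v≢1 (subst (numeral1 ⇓_) (fixed (⇓-functional zero⇓x I⇓) (i-β oneᶜ)) one⇓)
    refute (inj₂ (one⇓x , v≢0)) =
      v≢0 (subst (numeral0 ⇓_) (fixed (⇓-functional one⇓x one⇓) one-one) I⇓)

  injective-precomplete⇒total-extension :
    ∀ {ℓ'} {S : Set ℓ'} (γ : Carrier → S) → Injective _≡_ _≡_ γ → Precomplete γ →
    ∀ b → Σ Carrier λ f → Total f × f Extends b
  injective-precomplete⇒total-extension γ γ-injective γ-precomplete b
    with γ-precomplete b
  ... | f , f-total , f-tracks = f , f-total , extends
    where
    extends : f Extends b
    extends {a} {v} ba with f-tracks a v ba
    ... | w , fa , γw≡γv with γ-injective γw≡γv
    ... | refl = fa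

open Combinatory using (selfᶜ; self-application-not-totalizable; injective-precomplete⇒total-extension)

theorem9p2 : ∀ {ℓ ℓ'} (𝒜 : PCA ℓ) → PCATheory.Separable01 𝒜 →
    {S : Set ℓ'} (γ : PCA.Carrier 𝒜 → S) →
    PCATheory.IsGeneralizedNumbering 𝒜 γ → PCATheory.Precomplete 𝒜 γ →
    ¬ Injective _≡_ _≡_ γ
theorem9p2 𝒜 separable γ _ γ-precomplete γ-injective =
  let f , f-total , f-self = injective-precomplete⇒total-extension 𝒜 γ γ-injective γ-precomplete (selfᶜ 𝒜)
  in  self-application-not-totalizable 𝒜 separable f f-total f-self
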